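{- Writing $B_k^{nb}:=B_k^{neobc}$ and $C_k^{nb}:=C_k^{neobc}$, the balancing numbers $B_n$, cobalancing numbers $b_n$, Lucas-balancing numbers $C_n$ and Lucas-cobalancing numbers $c_n$ satisfy: $$B_n=\frac16\begin{cases}4B^{nb}_{\frac{n+1}{2}}-C^{nb}_{\frac{n+1}{2}}-3 & n\geq1 \text{ odd},\\ 20B^{nb}_{\frac{n+2}{2}}-7C^{nb}_{\frac{n+2}{2}}-15 & n\geq2\text{ even},\end{cases}$$ $$b_n=\frac1{12}\begin{cases}-16B^{nb}_{\frac{n+1}{2}}+6C^{nb}_{\frac{n+1}{2}}+6 & n\geq1 \text{ odd},\\ 20B^{nb}_{\frac{n+2}{2}}-4B^{nb}_{\frac{n}{2}}-7C^{nb}_{\frac{n+2}{2}}+C^{nb}_{\frac{n}{2}}-18 & n\geq2\text{ even},\end{cases}$$ $$C_n=\frac16\begin{cases}-8B^{nb}_{\frac{n+1}{2}}+4C^{nb}_{\frac{n+1}{2}}+6 & n\geq1 \text{ odd},\\ 60B^{nb}_{\frac{n+2}{2}}-4B^{nb}_{\frac{n}{2}}-21C^{nb}_{\frac{n+2}{2}}+C^{nb}_{\frac{n}{2}}-42 & n\geq2\text{ even},\end{cases}$$ $$c_n=\frac16\begin{cases}24B^{nb}_{\frac{n+1}{2}}-8C^{nb}_{\frac{n+1}{2}}-18 & n\geq1 \text{ odd},\\ 20B^{nb}_{\frac{n+2}{2}}+4B^{nb}_{\frac{n}{2}}-7C^{nb}_{\frac{n+2}{2}}-C^{nb}_{\frac{n}{2}}-18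 & n\geq2\text{ even}.\end{cases}$$
   Context: Let $\alpha=1+\sqrt2$, $\beta=1-\sqrt2$. For $n\ge1$: balancing numbers $B_n=\frac{\alpha^{2n}-\beta^{2n}}{4\sqrt2}$; cobalancing numbers $b_n=\frac{\alpha^{2n-1}-\beta^{2n-1}}{4\sqrt2}-\frac12$ (so $b_1=0,b_2=2,b_3=14$); Lucas-balancing numbers $C_n=\frac{\alpha^{2n}+\beta^{2n}}{2}=\sqrt{8B_n^2+1}$; Lucas-cobalancing numbers $c_n=\frac{\alpha^{2n-1}+\beta^{2n-1}}{2}=\sqrt{8b_n^2+8b_n+1}$. A positive integer $m$ is a neo balcobalancing number if there is a positive integer $r$ such that $(1+2+\cdots+(m-1))+(1+2+\cdots+m)=2[(m-1)+m+(m+1)+(m+2)+\cdots+(m+r)]$ (equivalently, $8m^2-12m+9$ is a perfect square). $B_k^{neobc}$ is the $k$-th neo balcobalancing number in increasing order ($k\ge1$) and $C_k^{neobc}=\sqrt{8(B_k^{neobc})^2-12B_k^{neobc}+9}$. -}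

module Defs where

open import Data.Nat as ℕ using (ℕ; zero; suc; _∸_; _<_; _≤_)
open import Data.Integer as ℤ using (ℤ; +_; _-_; -_)
open import Data.Product using (Σ; _×_)
open import Relation.Binary.PropositionalEquality using (_≡_)

-- Balancing numbers B_n = (α^{2n} - β^{2n}) / (4√2), via their recurrence
-- B_0 = 0, B_1 = 1, B_{n+2} = 6 B_{n+1} - B_n.
Bal : ℕ → ℤ
Bal zero = + 0
Bal (suc zero) = + 1
Bal (suc (suc n)) = (+ 6) ℤ.* Bal (suc n) - Bal n

-- Cobalancing numbers b_n (closed form value at 0 is b_0 = 0; b_1 = 0, b_2 = 2, b_3 = 14),
-- recurrence b_{n+2} = 6 b_{n+1} - b_n + 2.
Cobal : ℕ → ℤ
Cobal zero = + 0
Cobal (suc zero) = + 0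
Cobal (suc (suc n)) = (+ 6) ℤ.* Cobal (suc n) - Cobal n ℤ.+ + 2

-- Lucas-balancing numbers C_n = (α^{2n} + β^{2n}) / 2: C_0 = 1, C_1 = 3.
LucBal : ℕ → ℤ
LucBal zero = + 1
LucBal (suc zero) = + 3
LucBal (suc (suc n)) = (+ 6) ℤ.* LucBal (suc n) - LucBal n

-- Lucas-cobalancing numbers c_n = (α^{2n-1} + β^{2n-1}) / 2: c_0 = -1, c_1 = 1, c_2 = 7.
LucCobal : ℕ → ℤ
LucCobal zero = - (+ 1)
LucCobal (suc zero) = + 1
LucCobal (suc (suc n)) = (+ 6) ℤ.* LucCobal (suc n) - LucCobal n

tri : ℕ → ℕ
tri zero = 0
tri (suc m) = suc m ℕ.+ tri m

run : ℕ → ℕ → ℕ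
run m zero = m
run m (suc r) = run m r ℕ.+ (m ℕ.+ suc r)

IsNeoBC : ℕ → Set
IsNeoBC m = (1 ≤ m) × Σ ℕ (λ r → (1 ≤ r) ×
  (tri (m ∸ 1) ℕ.+ tri m ≡ 2 ℕ.* ((m ∸ 1) ℕ.+ run m r)))

-- f k (k ≥ 1) is the k-th neo balcobalancing number in increasing order
-- (f 0 is irrelevant).
NeoEnum : (ℕ → ℕ) → Set
NeoEnum f =
  (∀ k → 1 ≤ k → IsNeoBC (f k)) ×
  (∀ k → 1 ≤ k → f k < f (suc k)) ×
  (∀ m → IsNeoBC m → Σ ℕ (λ k → (1 ≤ k) × (f k ≡ m)))

-- g k = sqrt (8 (f k)^2 - 12 f k + 9) for k ≥ 1 (the quantity is always positive).
NeoC : (ℕ → ℕ) → (ℕ → ℕ) → Set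
NeoC f g = ∀ k → 1 ≤ k →
  g k ℕ.* g k ≡ (8 ℕ.* f k ℕ.* f k ℕ.+ 9) ∸ 12 ℕ.* f k

module Submission where

-- A positive m is neo balcobalancing iff x = 4m − 3 and y = C^nb solve x² + 9 = 2y² with y odd and
-- y ≥ 2m + 3. Descent along (x, y) ↦ (3x − 4y, 3y − 2x) shows that every solution lies on the orbit
-- (X_k, Y_k) of (3, 3) under (x, y) ↦ (3x + 4y, 2x + 3y), and reduction mod 4 shows that x = 4m − 3
-- picks out exactly the odd indices, so B^nb_{j+1} = (X_{2j+1} + 3)/4 and C^nb_{j+1} = Y_{2j+1}.
-- Since X, Y, B, C all satisfy u_{k+2} = 6u_{k+1} − u_k, comparing two initial values gives
-- X_k − Y_k = 6B_k and 2Y_k − X_k = 3C_k. Thus 6B_{2j+1} and 6C_{2j+1} are linear in B^nb_{j+1},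
-- C^nb_{j+1}, and the other identities follow from C_{n+1} = 3B_{n+1} − B_n,
-- 2b_{n+1} + 1 = B_{n+1} − B_n and c_{n+1} = B_{n+1} + B_n.

open import Defs
open import Data.List using ([]; _∷_)
open import Data.Nat as ℕ using (ℕ; zero; suc)
open import Data.Product using (Σ; ∃; _×_; _,_; proj₁; proj₂)
open import Relation.Binary.PropositionalEquality

module IncreasingSequences where

  open import Data.Nat
  open import Data.Nat.Properties

  StrictlyIncreasing : (ℕ → ℕ) → Set
  StrictlyIncreasing h = ∀ i → h i < h (suc i)

  increasing-mono-≤ : ∀ {h} → StrictlyIncreasing h → ∀ {i j} → i ≤ j → h i ≤ h j
  increasing-mono-≤ inc {j = zero}  z≤n = ≤-refl
  increasing-mono-≤ inc {j = suc j} z≤n = ≤-trans (increasing-mono-≤ inc z≤n) (<⇒≤ (inc j))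
  increasing-mono-≤ {h} inc (s≤s i≤j) = increasing-mono-≤ {λ i → h (suc i)} (λ i → inc (suc i)) i≤j

  increasing-mono-< : ∀ {h} → StrictlyIncreasing h → ∀ {i j} → i < j → h i < h j
  increasing-mono-< inc {i} i<j = <-≤-trans (inc i) (increasing-mono-≤ inc i<j)

  increasing-reflects-< : ∀ {h} → StrictlyIncreasing h → ∀ {i j} → h i < h j → i < j
  increasing-reflects-< inc hi<hj = ≰⇒> (λ j≤i → <⇒≱ hi<hj (increasing-mono-≤ inc j≤i))

  increasing-≥-id : ∀ {σ} → StrictlyIncreasing σ → ∀ j → j ≤ σ j
  increasing-≥-id inc zero    = z≤n
  increasing-≥-id inc (suc j) = ≤-<-trans (increasing-≥-id inc j) (inc j)

  -- The index σ j with h (σ j) = M j is strictly increasing in j, hence σ j ≥ j.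
  increasing-covering-≤ : ∀ {h M} → StrictlyIncreasing h → StrictlyIncreasing M →
    (∀ j → ∃ λ i → h i ≡ M j) → ∀ j → h j ≤ M j
  increasing-covering-≤ {h} {M} h-inc M-inc cover j = begin
    h j       ≤⟨ increasing-mono-≤ h-inc (increasing-≥-id σ-inc j) ⟩
    h (σ j)   ≡⟨ proj₂ (cover j) ⟩
    M j       ∎
    where
    open ≤-Reasoning
    σ = λ j → proj₁ (cover j)
    σ-inc : StrictlyIncreasing σ
    σ-inc j = increasing-reflects-< h-inc
      (subst₂ _<_ (sym (proj₂ (cover j))) (sym (proj₂ (cover (suc j)))) (M-inc j))

  increasing-same-range : ∀ {h M} → StrictlyIncreasing h → StrictlyIncreasing M →
    (∀ j → ∃ λ i → h i ≡ M j) → (∀ i → ∃ λ j → M j ≡ h i) → ∀ j → h j ≡ M j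
  increasing-same-range h-inc M-inc h⊇M M⊇h j =
    ≤-antisym (increasing-covering-≤ h-inc M-inc h⊇M j) (increasing-covering-≤ M-inc h-inc M⊇h j)

module PellEquation where

  open import Data.Empty using (⊥-elim)
  open import Data.Fin using (Fin; toℕ; fromℕ<)
  open import Data.Fin.Properties using (all?; toℕ-fromℕ<)
  open import Data.Nat
  open import Data.Nat.DivMod using (_%_; %-remove-+ʳ)
  open import Data.Nat.Divisibility using (m∣m*n)
  open import Data.Nat.Induction using (<-rec)
  open import Data.Nat.Properties
  open import Data.Nat.Tactic.RingSolver using (solve-∀; solve)
  open import Data.Sum using (_⊎_; inj₁; inj₂)
  open import Function using (_⇔_; mk⇔; Equivalence)
  open import Relation.Nullary.Decidable using (yes; no; from-yes; _×-dec_; _→-dec_)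

  -- For x = 4m − 3 this is y² = 8m² − 12m + 9.
  Pell : ℕ → ℕ → Set
  Pell x y = x * x + 9 ≡ 2 * (y * y)

  +-exchange-⇔ : ∀ {a b c d} → a + d ≡ c + b → (a ≡ c ⇔ b ≡ d)
  +-exchange-⇔ {a} {b} {c} {d} e = mk⇔
    (λ { refl → sym (+-cancelˡ-≡ a d b e) })
    (λ { refl → +-cancelʳ-≡ b a c e })

  square-≤-reflect : ∀ {a b} → a * a ≤ b * b → a ≤ b
  square-≤-reflect h = ≮⇒≥ (λ b<a → <⇒≱ (*-mono-< b<a b<a) h)

  square-<-reflect : ∀ {a b} → a * a < b * b → a < b
  square-<-reflect h = ≰⇒> (λ b≤a → <⇒≱ h (*-mono-≤ b≤a b≤a))

  square-injective : ∀ {a b} → a * a ≡ b * b → a ≡ b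
  square-injective h =
    ≤-antisym (square-≤-reflect (≤-reflexive h)) (square-≤-reflect (≤-reflexive (sym h)))

  pell-step-⇔ : ∀ x y → Pell x y ⇔ Pell (3 * x + 4 * y) (2 * x + 3 * y)
  pell-step-⇔ x y = +-exchange-⇔ (identity x y)
    where
    identity : ∀ x y → (x * x + 9) + 2 * ((2 * x + 3 * y) * (2 * x + 3 * y))
                     ≡ 2 * (y * y) + ((3 * x + 4 * y) * (3 * x + 4 * y) + 9)
    identity = solve-∀

  mutual
    pellX : ℕ → ℕ
    pellX zero    = 3
    pellX (suc k) = 3 * pellX k + 4 * pellY k

    pellY : ℕ → ℕ
    pellY zero    = 3
    pellY (suc k) = 2 * pellX k + 3 * pellY k

  pell-orbit : ∀ k → Pell (pellX k) (pellY k)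
  pell-orbit zero    = refl
  pell-orbit (suc k) = Equivalence.to (pell-step-⇔ (pellX k) (pellY k)) (pell-orbit k)

  pellY-positive : ∀ k → 0 < pellY k
  pellY-positive zero    = s≤s z≤n
  pellY-positive (suc k) =
    ≤-trans (pellY-positive k) (≤-trans (m≤n*m (pellY k) 3) (m≤n+m (3 * pellY k) (2 * pellX k)))

  pellX-increasing : ∀ k → pellX k < pellX (suc k)
  pellX-increasing k = begin-strict
    pellX k                       <⟨ m<m+n (pellX k) (*-monoʳ-< 4 (pellY-positive k)) ⟩
    pellX k + 4 * pellY k         ≤⟨ +-mono-≤ (m≤n*m (pellX k) 3) ≤-refl ⟩
    3 * pellX k + 4 * pellY k     ∎
    where open ≤-Reasoning

  small-pell : ∀ x y → x < 9 → Pell x y → x ≡ 3 × y ≡ 3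
  small-pell x y x<9 e =
    subst₂ (λ a b → a ≡ 3 × b ≡ 3) x≡ y≡
      (table (fromℕ< x<9) (fromℕ< y<7) (subst₂ Pell (sym x≡) (sym y≡) e))
    where
    table : ∀ (i : Fin 9) (j : Fin 7) → Pell (toℕ i) (toℕ j) → toℕ i ≡ 3 × toℕ j ≡ 3
    table = from-yes (all? λ (i : Fin 9) → all? λ (j : Fin 7) →
      (toℕ i * toℕ i + 9 ≟ 2 * (toℕ j * toℕ j)) →-dec ((toℕ i ≟ 3) ×-dec (toℕ j ≟ 3)))
    y<7 : y < 7
    y<7 = square-<-reflect (*-cancelˡ-< 2 (y * y) (7 * 7) (begin-strict
      2 * (y * y)   ≡⟨ sym e ⟩
      x * x + 9     ≤⟨ +-mono-≤ (*-mono-≤ (≤-pred x<9) (≤-pred x<9)) ≤-refl ⟩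
      73            <⟨ from-yes (73 <? 98) ⟩
      2 * (7 * 7)   ∎))
      where open ≤-Reasoning
    x≡ = toℕ-fromℕ< x<9
    y≡ = toℕ-fromℕ< y<7

  pell-x<2y : ∀ {x y} → Pell x y → x < 2 * y
  pell-x<2y {x} {y} e = square-<-reflect (begin-strict
    x * x                    <⟨ m<m+n (x * x) (s≤s z≤n) ⟩
    x * x + (18 + x * x)     ≡⟨ solve (x ∷ []) ⟩
    2 * (x * x + 9)          ≡⟨ cong (2 *_) e ⟩
    2 * (2 * (y * y))        ≡⟨ solve (y ∷ []) ⟩
    (2 * y) * (2 * y)        ∎)
    where open ≤-Reasoning

  pell-2x≤3y : ∀ {x y} → Pell x y → 2 * x ≤ 3 * y
  pell-2x≤3y {x} {y} e = square-≤-reflect (*-cancelˡ-≤ 2 (begin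
    2 * ((2 * x) * (2 * x))                ≤⟨ m≤m+n _ (x * x + 81) ⟩
    2 * ((2 * x) * (2 * x)) + (x * x + 81) ≡⟨ solve (x ∷ []) ⟩
    9 * (x * x + 9)                        ≡⟨ cong (9 *_) e ⟩
    9 * (2 * (y * y))                      ≡⟨ solve (y ∷ []) ⟩
    2 * ((3 * y) * (3 * y))                ∎))
    where open ≤-Reasoning

  pell-4y≤3x : ∀ {x y} → 9 ≤ x → Pell x y → 4 * y ≤ 3 * x
  pell-4y≤3x {x} {y} 9≤x e = square-≤-reflect (begin
    (4 * y) * (4 * y)        ≡⟨ solve (y ∷ []) ⟩
    8 * (2 * (y * y))        ≡⟨ cong (8 *_) (sym e) ⟩
    8 * (x * x + 9)          ≡⟨ solve (x ∷ []) ⟩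
    8 * (x * x) + 72
      ≤⟨ +-monoʳ-≤ (8 * (x * x)) (≤-trans (from-yes (72 ≤? 81)) (*-mono-≤ 9≤x 9≤x)) ⟩
    8 * (x * x) + x * x      ≡⟨ solve (x ∷ []) ⟩
    (3 * x) * (3 * x)        ∎)
    where open ≤-Reasoning

  PellPredecessor : ℕ → ℕ → Set
  PellPredecessor x y =
    Σ ℕ λ x' → Σ ℕ λ y' → x' < x × Pell x' y' × x ≡ 3 * x' + 4 * y' × y ≡ 2 * x' + 3 * y'

  pell-descent : ∀ {x y} → 9 ≤ x → Pell x y → PellPredecessor x y
  pell-descent {x} {y} 9≤x e =
    descend (m≤n⇒∃[o]m+o≡n (pell-4y≤3x {x} {y} 9≤x e)) (m≤n⇒∃[o]m+o≡n (pell-2x≤3y {x} {y} e))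
    where
    descend : (∃ λ x' → 4 * y + x' ≡ 3 * x) → (∃ λ y' → 2 * x + y' ≡ 3 * y) → PellPredecessor x y
    descend (x' , hx) (y' , hy) =
      x' , y' , x'<x , Equivalence.from (pell-step-⇔ x' y') (subst₂ Pell x≡ y≡ e) , x≡ , y≡
      where
      x'<x : x' < x
      x'<x = +-cancelˡ-< (4 * y) x' x (begin-strict
        4 * y + x'      ≡⟨ hx ⟩
        3 * x           ≡⟨ solve (x ∷ []) ⟩
        2 * x + x       <⟨ +-monoˡ-< x (*-monoʳ-< 2 (pell-x<2y {x} {y} e)) ⟩
        2 * (2 * y) + x ≡⟨ solve (x ∷ y ∷ []) ⟩
        4 * y + x       ∎)
        where open ≤-Reasoning
      x≡ : x ≡ 3 * x' + 4 * y'
      x≡ = +-cancelʳ-≡ (8 * x + 12 * y) x (3 * x' + 4 * y') (begin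
        x + (8 * x + 12 * y)                  ≡⟨ solve (x ∷ y ∷ []) ⟩
        3 * (3 * x) + 4 * (3 * y)             ≡⟨ cong₂ (λ u v → 3 * u + 4 * v) (sym hx) (sym hy) ⟩
        3 * (4 * y + x') + 4 * (2 * x + y')   ≡⟨ solve (x ∷ y ∷ x' ∷ y' ∷ []) ⟩
        3 * x' + 4 * y' + (8 * x + 12 * y)    ∎)
        where open ≡-Reasoning
      y≡ : y ≡ 2 * x' + 3 * y'
      y≡ = +-cancelʳ-≡ (6 * x + 8 * y) y (2 * x' + 3 * y') (begin
        y + (6 * x + 8 * y)                   ≡⟨ solve (x ∷ y ∷ []) ⟩
        2 * (3 * x) + 3 * (3 * y)             ≡⟨ cong₂ (λ u v → 2 * u + 3 * v) (sym hx) (sym hy) ⟩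
        2 * (4 * y + x') + 3 * (2 * x + y')   ≡⟨ solve (x ∷ y ∷ x' ∷ y' ∷ []) ⟩
        2 * x' + 3 * y' + (6 * x + 8 * y)     ∎)
        where open ≡-Reasoning

  -- The descent step applies once x ≥ 9; below that (3, 3) is the only solution.
  pell-in-orbit : ∀ x y → Pell x y → ∃ λ k → x ≡ pellX k × y ≡ pellY k
  pell-in-orbit = <-rec _ descend
    where
    InOrbit : ℕ → Set
    InOrbit x = ∀ y → Pell x y → ∃ λ k → x ≡ pellX k × y ≡ pellY k
    descend : ∀ x → (∀ {x'} → x' < x → InOrbit x') → InOrbit x
    descend x rec y e with x <? 9
    ... | yes x<9 = 0 , small-pell x y x<9 e
    ... | no x≮9 = step (pell-descent (≮⇒≥ x≮9) e)
      where
      step : PellPredecessor x y → ∃ λ k → x ≡ pellX k × y ≡ pellY k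
      step (x' , y' , x'<x , e' , refl , refl) with rec x'<x y' e'
      ... | k , refl , refl = suc k , refl , refl

  pell-two-steps : ∀ k → pellX (suc (suc k)) ≡ 17 * pellX k + 24 * pellY k
                       × pellY (suc (suc k)) ≡ 12 * pellX k + 17 * pellY k
  pell-two-steps k = identityX (pellX k) (pellY k) , identityY (pellX k) (pellY k)
    where
    identityX : ∀ x y → 3 * (3 * x + 4 * y) + 4 * (2 * x + 3 * y) ≡ 17 * x + 24 * y
    identityX = solve-∀
    identityY : ∀ x y → 2 * (3 * x + 4 * y) + 3 * (2 * x + 3 * y) ≡ 12 * x + 17 * y
    identityY = solve-∀

  -- a + 1 is a neo balcobalancing number and r its run length.
  pell-odd-orbit : ∀ j → Σ ℕ λ a → Σ ℕ λ r → 1 ≤ r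
    × pellX (suc (j + j)) ≡ 1 + 4 * a × pellY (suc (j + j)) ≡ 3 + 2 * r + 2 * a
  pell-odd-orbit zero = 5 , 1 , s≤s z≤n , refl , refl
  pell-odd-orbit (suc j) rewrite +-suc j j with pell-odd-orbit j
  ... | a , r , _ , hx , hy = 22 + 29 * a + 12 * r , 8 + 12 * a + 5 * r , s≤s z≤n , x≡ , y≡
    where
    open ≡-Reasoning
    p = suc (j + j)
    x≡ : pellX (suc (suc p)) ≡ 1 + 4 * (22 + 29 * a + 12 * r)
    x≡ = begin
      pellX (suc (suc p))                            ≡⟨ proj₁ (pell-two-steps p) ⟩
      17 * pellX p + 24 * pellY p                    ≡⟨ cong₂ (λ u v → 17 * u + 24 * v) hx hy ⟩
      17 * (1 + 4 * a) + 24 * (3 + 2 * r + 2 * a)    ≡⟨ solve (a ∷ r ∷ []) ⟩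
      1 + 4 * (22 + 29 * a + 12 * r)                 ∎
    y≡ : pellY (suc (suc p)) ≡ 3 + 2 * (8 + 12 * a + 5 * r) + 2 * (22 + 29 * a + 12 * r)
    y≡ = begin
      pellY (suc (suc p))                            ≡⟨ proj₂ (pell-two-steps p) ⟩
      12 * pellX p + 17 * pellY p                    ≡⟨ cong₂ (λ u v → 12 * u + 17 * v) hx hy ⟩
      12 * (1 + 4 * a) + 17 * (3 + 2 * r + 2 * a)    ≡⟨ solve (a ∷ r ∷ []) ⟩
      3 + 2 * (8 + 12 * a + 5 * r) + 2 * (22 + 29 * a + 12 * r) ∎

  pell-even-orbit : ∀ j → ∃ λ e → pellX (j + j) ≡ 3 + 4 * e
  pell-even-orbit zero = 0 , refl
  pell-even-orbit (suc j) rewrite +-suc j j with pell-odd-orbit j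
  ... | a , _ , _ , hx , _ = 3 * a + pellY p , (begin
      3 * pellX p + 4 * pellY p     ≡⟨ cong (λ u → 3 * u + 4 * pellY p) hx ⟩
      3 * (1 + 4 * a) + 4 * pellY p ≡⟨ identity a (pellY p) ⟩
      3 + 4 * (3 * a + pellY p)     ∎)
    where
    open ≡-Reasoning
    p = suc (j + j)
    identity : ∀ a y → 3 * (1 + 4 * a) + 4 * y ≡ 3 + 4 * (3 * a + y)
    identity = solve-∀

  even-or-odd : ∀ k → ∃ λ j → k ≡ j + j ⊎ k ≡ suc (j + j)
  even-or-odd zero = 0 , inj₁ refl
  even-or-odd (suc k) with even-or-odd k
  ... | j , inj₁ refl = j , inj₂ refl
  ... | j , inj₂ refl = suc j , inj₁ (cong suc (sym (+-suc j j)))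

  1+4a≢3+4b : ∀ a b → 1 + 4 * a ≢ 3 + 4 * b
  1+4a≢3+4b a b eq = 1≢3 (begin
    1 % 4                ≡⟨ %-remove-+ʳ 1 {4 * a} {4} (m∣m*n a) ⟨
    (1 + 4 * a) % 4      ≡⟨ cong (_% 4) eq ⟩
    (3 + 4 * b) % 4      ≡⟨ %-remove-+ʳ 3 {4 * b} {4} (m∣m*n b) ⟩
    3 % 4                ∎)
    where
    open ≡-Reasoning
    1≢3 : 1 ≢ 3
    1≢3 ()

  pellX≡1+4a⇒odd : ∀ k {a} → pellX k ≡ 1 + 4 * a → ∃ λ j → k ≡ suc (j + j)
  pellX≡1+4a⇒odd k {a} hx with even-or-odd k
  ... | j , inj₂ k≡ = j , k≡
  ... | j , inj₁ refl with pell-even-orbit j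
  ...   | e , he = ⊥-elim (1+4a≢3+4b a e (trans (sym hx) he))

module NeoBalcobalancing where

  open IncreasingSequences
  open PellEquation
  open import Data.Nat
  open import Data.Nat.Properties
  open import Data.Nat.Tactic.RingSolver using (solve-∀; solve)
  open import Function using (_⇔_; mk⇔; Equivalence)
  import Function.Properties.Equivalence as ⇔

  double-tri : ∀ n → 2 * tri n ≡ n * suc n
  double-tri zero    = refl
  double-tri (suc n) = begin
    2 * (suc n + tri n)           ≡⟨ *-distribˡ-+ 2 (suc n) (tri n) ⟩
    2 * suc n + 2 * tri n         ≡⟨ cong (2 * suc n +_) (double-tri n) ⟩
    2 * suc n + n * suc n         ≡⟨ solve (n ∷ []) ⟩
    suc n * suc (suc n)           ∎
    where open ≡-Reasoning

  tri-consecutive : ∀ n → tri n + tri (suc n) ≡ suc n * suc n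
  tri-consecutive n = *-cancelˡ-≡ _ _ 2 (begin
    2 * (tri n + tri (suc n))        ≡⟨ *-distribˡ-+ 2 (tri n) (tri (suc n)) ⟩
    2 * tri n + 2 * tri (suc n)      ≡⟨ cong₂ _+_ (double-tri n) (double-tri (suc n)) ⟩
    n * suc n + suc n * suc (suc n)  ≡⟨ solve (n ∷ []) ⟩
    2 * (suc n * suc n)              ∎)
    where open ≡-Reasoning

  double-run : ∀ m r → 2 * run m r ≡ suc r * (2 * m + r)
  double-run m zero    = sym (trans (*-identityˡ (2 * m + 0)) (+-identityʳ (2 * m)))
  double-run m (suc r) = begin
    2 * (run m r + (m + suc r))           ≡⟨ *-distribˡ-+ 2 (run m r) (m + suc r) ⟩
    2 * run m r + 2 * (m + suc r)         ≡⟨ cong (_+ 2 * (m + suc r)) (double-run m r) ⟩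
    suc r * (2 * m + r) + 2 * (m + suc r) ≡⟨ solve (m ∷ r ∷ []) ⟩
    suc (suc r) * (2 * m + suc r)         ∎
    where open ≡-Reasoning

  *-cancel-⇔ : ∀ k .{{_ : NonZero k}} {a b} → a ≡ b ⇔ k * a ≡ k * b
  *-cancel-⇔ k = mk⇔ (cong (k *_)) (*-cancelˡ-≡ _ _ k)

  -- For m = m' + 1, x = 4m − 3 and y = 2m + 2r + 1 the two sides differ by (x² + 9 − 2y²)/8.
  neo-equation-⇔-pell : ∀ m' r → tri m' + tri (suc m') ≡ 2 * (m' + run (suc m') r)
                               ⇔ Pell (1 + 4 * m') (3 + 2 * r + 2 * m')
  neo-equation-⇔-pell m' r
    rewrite tri-consecutive m' | *-distribˡ-+ 2 m' (run (suc m') r) | double-run (suc m') r =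
    ⇔.trans (*-cancel-⇔ 8) (⇔.sym (+-exchange-⇔ (identity m' r)))
    where
    identity : ∀ m' r → (1 + 4 * m') * (1 + 4 * m') + 9 + 8 * (2 * m' + suc r * (2 * suc m' + r))
                      ≡ 2 * ((3 + 2 * r + 2 * m') * (3 + 2 * r + 2 * m')) + 8 * (suc m' * suc m')
    identity = solve-∀

  pell⇒neo : ∀ {m' r} → 1 ≤ r → Pell (1 + 4 * m') (3 + 2 * r + 2 * m') → IsNeoBC (suc m')
  pell⇒neo {m'} {r} 1≤r e = s≤s z≤n , r , 1≤r , Equivalence.from (neo-equation-⇔-pell m' r) e

  neo⇒pell : ∀ {m} → IsNeoBC m → Σ ℕ λ m' → Σ ℕ λ y → m ≡ suc m' × Pell (1 + 4 * m') y
  neo⇒pell {suc m'} (_ , r , _ , e) = m' , 3 + 2 * r + 2 * m' , refl , Equivalence.to (neo-equation-⇔-pell m' r) e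

  pell-companion : ∀ {m' y} → Pell (1 + 4 * m') y → y * y ≡ (8 * suc m' * suc m' + 9) ∸ 12 * suc m'
  pell-companion {m'} {y} e = begin
    y * y                                     ≡⟨ m+n∸n≡m (y * y) (12 * suc m') ⟨
    (y * y + 12 * suc m') ∸ 12 * suc m'
      ≡⟨ cong (_∸ 12 * suc m') (*-cancelˡ-≡ (y * y + 12 * suc m') (8 * suc m' * suc m' + 9) 2 doubled) ⟩
    (8 * suc m' * suc m' + 9) ∸ 12 * suc m'   ∎
    where
    open ≡-Reasoning
    doubled : 2 * (y * y + 12 * suc m') ≡ 2 * (8 * suc m' * suc m' + 9)
    doubled = begin
      2 * (y * y + 12 * suc m')                         ≡⟨ solve (y ∷ m' ∷ []) ⟩
      2 * (y * y) + 24 * suc m'                         ≡⟨ cong (_+ 24 * suc m') e ⟨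
      (1 + 4 * m') * (1 + 4 * m') + 9 + 24 * suc m'     ≡⟨ solve (m' ∷ []) ⟩
      2 * (8 * suc m' * suc m' + 9)                     ∎

  module _ {f : ℕ → ℕ} (enum : NeoEnum f) where

    open ≡-Reasoning

    private
      neo = proj₁ enum
      f-increasing = proj₁ (proj₂ enum)
      f-complete = proj₂ (proj₂ enum)

    neo-enumeration : ∀ j → 4 * f (suc j) ≡ pellX (suc (j + j)) + 3
    neo-enumeration = increasing-same-range h-increasing M-increasing h⊇M M⊇h
      where
      h M : ℕ → ℕ
      h j = 4 * f (suc j)
      M j = pellX (suc (j + j)) + 3
      h-increasing : StrictlyIncreasing h
      h-increasing j = *-monoʳ-< 4 (f-increasing (suc j) (s≤s z≤n))
      M-increasing : StrictlyIncreasing M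
      M-increasing j = +-monoˡ-< 3 (increasing-mono-< pellX-increasing (s≤s (+-mono-< (n<1+n j) (n<1+n j))))
      h⊇M : ∀ j → ∃ λ i → h i ≡ M j
      h⊇M j with pell-odd-orbit j
      ... | a , r , 1≤r , hx , hy
          with f-complete (suc a) (pell⇒neo 1≤r (subst₂ Pell hx hy (pell-orbit (suc (j + j)))))
      ...   | suc i , _ , fi≡ = i , (begin
        4 * f (suc i)            ≡⟨ cong (4 *_) fi≡ ⟩
        4 * suc a                ≡⟨ solve (a ∷ []) ⟩
        1 + 4 * a + 3            ≡⟨ cong (_+ 3) hx ⟨
        pellX (suc (j + j)) + 3  ∎)
      M⊇h : ∀ i → ∃ λ j → M j ≡ h i
      M⊇h i with neo⇒pell (neo (suc i) (s≤s z≤n))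
      ... | m' , y , fi≡ , e with pell-in-orbit (1 + 4 * m') y e
      ...   | k , x≡ , _ with pellX≡1+4a⇒odd k {m'} (sym x≡)
      ...     | j , refl = j , (begin
        pellX (suc (j + j)) + 3  ≡⟨ cong (_+ 3) x≡ ⟨
        1 + 4 * m' + 3           ≡⟨ solve (m' ∷ []) ⟩
        4 * suc m'               ≡⟨ cong (4 *_) fi≡ ⟨
        4 * f (suc i)            ∎)

    neo-companion : ∀ {g} → NeoC f g → ∀ j → g (suc j) ≡ pellY (suc (j + j))
    neo-companion {g} g² j with pell-odd-orbit j
    ... | a , _ , _ , hx , _ = square-injective (begin
      g (suc j) * g (suc j)                               ≡⟨ g² (suc j) (s≤s z≤n) ⟩
      (8 * f (suc j) * f (suc j) + 9) ∸ 12 * f (suc j)    ≡⟨ cong (λ m → (8 * m * m + 9) ∸ 12 * m) f≡ ⟩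
      (8 * suc a * suc a + 9) ∸ 12 * suc a
        ≡⟨ pell-companion {a} {pellY p} (subst (λ x → Pell x (pellY p)) hx (pell-orbit p)) ⟨
      pellY p * pellY p                                   ∎)
      where
      p = suc (j + j)
      f≡ : f (suc j) ≡ suc a
      f≡ = *-cancelˡ-≡ (f (suc j)) (suc a) 4 (begin
        4 * f (suc j)        ≡⟨ neo-enumeration j ⟩
        pellX p + 3          ≡⟨ cong (_+ 3) hx ⟩
        1 + 4 * a + 3        ≡⟨ solve (a ∷ []) ⟩
        4 * suc a            ∎)

open PellEquation using (pellX; pellY)
open NeoBalcobalancing using (neo-enumeration; neo-companion)

open import Data.Integer using (ℤ; +_; _+_; _-_; _*_; -_)
open import Data.Integer.Properties using (pos-+; pos-*)
open import Data.Integer.Tactic.RingSolver using (solve-∀; solve)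
open import Data.Nat.Properties using (+-suc)
import Data.Nat.Tactic.RingSolver as ℕ-Solver

-- A record, so that the sequence can be inferred from a proof.
record IsBalancingLike (u : ℕ → ℤ) : Set where
  constructor balancing-like
  field recurrence : ∀ n → u (suc (suc n)) ≡ + 6 * u (suc n) - u n

open IsBalancingLike

balancing-like-unique : ∀ {u v} → IsBalancingLike u → IsBalancingLike v →
  u 0 ≡ v 0 → u 1 ≡ v 1 → ∀ n → u n ≡ v n
balancing-like-unique {u} {v} (balancing-like hu) (balancing-like hv) e₀ e₁ n = proj₁ (pairs n)
  where
  pairs : ∀ n → u n ≡ v n × u (suc n) ≡ v (suc n)
  pairs zero    = e₀ , e₁
  pairs (suc n) with pairs n
  ... | eₙ , eₙ₊₁ =
    eₙ₊₁ , trans (hu n) (trans (cong₂ (λ a b → + 6 * a - b) eₙ₊₁ eₙ) (sym (hv n)))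

module _ {u v : ℕ → ℤ} (hu : IsBalancingLike u) (hv : IsBalancingLike v) where

  +-balancing-like : IsBalancingLike (λ n → u n + v n)
  +-balancing-like .recurrence n =
    trans (cong₂ _+_ (hu .recurrence n) (hv .recurrence n)) (identity (u (suc n)) (u n) (v (suc n)) (v n))
    where
    identity : ∀ a b c d → (+ 6 * a - b) + (+ 6 * c - d) ≡ + 6 * (a + c) - (b + d)
    identity = solve-∀

  -‿balancing-like : IsBalancingLike (λ n → u n - v n)
  -‿balancing-like .recurrence n =
    trans (cong₂ _-_ (hu .recurrence n) (hv .recurrence n)) (identity (u (suc n)) (u n) (v (suc n)) (v n))
    where
    identity : ∀ a b c d → (+ 6 * a - b) - (+ 6 * c - d) ≡ + 6 * (a - c) - (b - d)
    identity = solve-∀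

*-balancing-like : ∀ c {u} → IsBalancingLike u → IsBalancingLike (λ n → c * u n)
*-balancing-like c {u} hu .recurrence n = trans (cong (c *_) (hu .recurrence n)) (identity c (u (suc n)) (u n))
  where
  identity : ∀ c a b → c * (+ 6 * a - b) ≡ + 6 * (c * a) - c * b
  identity = solve-∀

shift-balancing-like : ∀ {u} → IsBalancingLike u → IsBalancingLike (λ n → u (suc n))
shift-balancing-like hu .recurrence n = hu .recurrence (suc n)

Bal-balancing-like : IsBalancingLike Bal
Bal-balancing-like .recurrence n = refl

LucBal-balancing-like : IsBalancingLike LucBal
LucBal-balancing-like .recurrence n = refl

LucCobal-balancing-like : IsBalancingLike LucCobal
LucCobal-balancing-like .recurrence n = refl

-- 2 b_n + 1 absorbs the inhomogeneous term of the cobalancing recurrence.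
Cobal-balancing-like : IsBalancingLike (λ n → + 2 * Cobal n + + 1)
Cobal-balancing-like .recurrence n = identity (Cobal (suc n)) (Cobal n)
  where
  identity : ∀ b₁ b₀ → + 2 * (+ 6 * b₁ - b₀ + + 2) + + 1 ≡ + 6 * (+ 2 * b₁ + + 1) - (+ 2 * b₀ + + 1)
  identity = solve-∀

ℕ-balancing-like : ∀ {a : ℕ → ℕ} → (∀ n → a (suc (suc n)) ℕ.+ a n ≡ 6 ℕ.* a (suc n)) →
  IsBalancingLike (λ n → + a n)
ℕ-balancing-like {a} rec .recurrence n = begin
  + a (suc (suc n))                            ≡⟨ identity (+ a (suc (suc n))) (+ a n) ⟩
  (+ a (suc (suc n)) + + a n) - + a n          ≡⟨ cong (_- + a n) (pos-+ (a (suc (suc n))) (a n)) ⟨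
  + (a (suc (suc n)) ℕ.+ a n) - + a n          ≡⟨ cong (λ t → + t - + a n) (rec n) ⟩
  + (6 ℕ.* a (suc n)) - + a n                  ≡⟨ cong (_- + a n) (pos-* 6 (a (suc n))) ⟩
  + 6 * + a (suc n) - + a n                    ∎
  where
  open ≡-Reasoning
  identity : ∀ x y → x ≡ (x + y) - y
  identity = solve-∀

pellX-balancing-like : IsBalancingLike (λ k → + pellX k)
pellX-balancing-like = ℕ-balancing-like (λ k → identity (pellX k) (pellY k))
  where
  identity : ∀ x y → 3 ℕ.* (3 ℕ.* x ℕ.+ 4 ℕ.* y) ℕ.+ 4 ℕ.* (2 ℕ.* x ℕ.+ 3 ℕ.* y) ℕ.+ x
                   ≡ 6 ℕ.* (3 ℕ.* x ℕ.+ 4 ℕ.* y)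
  identity = ℕ-Solver.solve-∀

pellY-balancing-like : IsBalancingLike (λ k → + pellY k)
pellY-balancing-like = ℕ-balancing-like (λ k → identity (pellX k) (pellY k))
  where
  identity : ∀ x y → 2 ℕ.* (3 ℕ.* x ℕ.+ 4 ℕ.* y) ℕ.+ 3 ℕ.* (2 ℕ.* x ℕ.+ 3 ℕ.* y) ℕ.+ y
                   ≡ 6 ℕ.* (2 ℕ.* x ℕ.+ 3 ℕ.* y)
  identity = ℕ-Solver.solve-∀

Bal-from-pell : ∀ k → + 6 * Bal k ≡ + pellX k - + pellY k
Bal-from-pell = balancing-like-unique
  (*-balancing-like (+ 6) Bal-balancing-like)
  (-‿balancing-like pellX-balancing-like pellY-balancing-like)
  refl refl

LucBal-from-pell : ∀ k → + 6 * LucBal k ≡ + 4 * + pellY k - + 2 * + pellX k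
LucBal-from-pell = balancing-like-unique
  (*-balancing-like (+ 6) LucBal-balancing-like)
  (-‿balancing-like (*-balancing-like (+ 4) pellY-balancing-like) (*-balancing-like (+ 2) pellX-balancing-like))
  refl refl

LucBal-suc : ∀ n → LucBal (suc n) ≡ + 3 * Bal (suc n) - Bal n
LucBal-suc = balancing-like-unique
  (shift-balancing-like LucBal-balancing-like)
  (-‿balancing-like (*-balancing-like (+ 3) (shift-balancing-like Bal-balancing-like)) Bal-balancing-like)
  refl refl

Cobal-suc : ∀ n → + 2 * Cobal (suc n) + + 1 ≡ Bal (suc n) - Bal n
Cobal-suc = balancing-like-unique
  (shift-balancing-like Cobal-balancing-like)
  (-‿balancing-like (shift-balancing-like Bal-balancing-like) Bal-balancing-like)
  refl refl

LucCobal-suc : ∀ n → LucCobal (suc n) ≡ Bal (suc n) + Bal n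
LucCobal-suc = balancing-like-unique
  (shift-balancing-like LucCobal-balancing-like)
  (+-balancing-like (shift-balancing-like Bal-balancing-like) Bal-balancing-like)
  refl refl

sixfold-consecutive : ∀ n {P Q} → + 6 * Bal (suc n) ≡ P → + 6 * Bal n ≡ Q →
    (+ 12 * Cobal (suc n) ≡ P - Q - + 6)
  × (+ 6 * LucBal (suc n) ≡ + 3 * P - Q)
  × (+ 6 * LucCobal (suc n) ≡ P + Q)
sixfold-consecutive n refl refl = algebra (Bal n) (Bal (suc n)) (LucBal-suc n) (Cobal-suc n) (LucCobal-suc n)
  where
  algebra : ∀ B₀ B₁ {C b c} → C ≡ + 3 * B₁ - B₀ → + 2 * b + + 1 ≡ B₁ - B₀ → c ≡ B₁ + B₀ →
      (+ 12 * b ≡ + 6 * B₁ - + 6 * B₀ - + 6)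
    × (+ 6 * C ≡ + 3 * (+ 6 * B₁) - + 6 * B₀)
    × (+ 6 * c ≡ + 6 * B₁ + + 6 * B₀)
  algebra B₀ B₁ {b = b} refl hb refl =
    (begin
      + 12 * b                      ≡⟨ solve (b ∷ []) ⟩
      + 6 * (+ 2 * b + + 1) - + 6   ≡⟨ cong (λ t → + 6 * t - + 6) hb ⟩
      + 6 * (B₁ - B₀) - + 6         ≡⟨ solve (B₀ ∷ B₁ ∷ []) ⟩
      + 6 * B₁ - + 6 * B₀ - + 6     ∎) ,
    solve (B₀ ∷ B₁ ∷ []) ,
    solve (B₀ ∷ B₁ ∷ [])
    where open ≡-Reasoning

previous-balancing : ∀ n {P R} → + 6 * Bal (suc n) ≡ P → + 6 * LucBal (suc n) ≡ R →
  + 6 * Bal n ≡ + 3 * P - R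
previous-balancing n refl refl = algebra (Bal n) (Bal (suc n)) (LucBal-suc n)
  where
  algebra : ∀ B₀ B₁ {C} → C ≡ + 3 * B₁ - B₀ → + 6 * B₀ ≡ + 3 * (+ 6 * B₁) - + 6 * C
  algebra B₀ B₁ refl = solve (B₀ ∷ B₁ ∷ [])

odd-identities : ∀ n (F G : ℤ) →
  + 6 * Bal (suc n) ≡ + 4 * F - G - + 3 → + 6 * LucBal (suc n) ≡ - (+ 8) * F + + 4 * G + + 6 →
    (+ 6 * Bal (suc n) ≡ + 4 * F - G - + 3)
  × (+ 12 * Cobal (suc n) ≡ - (+ 16) * F + + 6 * G + + 6)
  × (+ 6 * LucBal (suc n) ≡ - (+ 8) * F + + 4 * G + + 6)
  × (+ 6 * LucCobal (suc n) ≡ + 24 * F - + 8 * G - + 18)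
odd-identities n F G hB hC =
  hB , trans (proj₁ six) (solve (F ∷ G ∷ [])) , hC , trans (proj₂ (proj₂ six)) (solve (F ∷ G ∷ []))
  where six = sixfold-consecutive n hB (previous-balancing n hB hC)

even-identities : ∀ j (F G F' G' : ℤ) →
  + 6 * Bal (suc (j ℕ.+ j)) ≡ + 4 * F - G - + 3 →
  + 6 * Bal (suc (suc j ℕ.+ suc j)) ≡ + 4 * F' - G' - + 3 →
  + 6 * LucBal (suc (suc j ℕ.+ suc j)) ≡ - (+ 8) * F' + + 4 * G' + + 6 →
    (+ 6 * Bal (suc (suc (j ℕ.+ j))) ≡ + 20 * F' - + 7 * G' - + 15)
  × (+ 12 * Cobal (suc (suc (j ℕ.+ j))) ≡ + 20 * F' - + 4 * F - + 7 * G' + G - + 18)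
  × (+ 6 * LucBal (suc (suc (j ℕ.+ j))) ≡ + 60 * F' - + 4 * F - + 21 * G' + G - + 42)
  × (+ 6 * LucCobal (suc (suc (j ℕ.+ j))) ≡ + 20 * F' + + 4 * F - + 7 * G' - G - + 18)
even-identities j F G F' G' hB hB' hC' =
  trans hB₁ (solve (F' ∷ G' ∷ [])) ,
  trans (proj₁ six) (solve (F ∷ G ∷ F' ∷ G' ∷ [])) ,
  trans (proj₁ (proj₂ six)) (solve (F ∷ G ∷ F' ∷ G' ∷ [])) ,
  trans (proj₂ (proj₂ six)) (solve (F ∷ G ∷ F' ∷ G' ∷ []))
  where
  hB₁ : + 6 * Bal (suc (suc (j ℕ.+ j))) ≡ + 3 * (+ 4 * F' - G' - + 3) - (- (+ 8) * F' + + 4 * G' + + 6)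
  hB₁ = trans (cong (λ k → + 6 * Bal (suc k)) (sym (+-suc j j)))
              (previous-balancing (suc (j ℕ.+ suc j)) hB' hC')
  six = sixfold-consecutive (suc (j ℕ.+ j)) hB₁ hB

pellX-from-neo : ∀ {x m} → 4 ℕ.* m ≡ x ℕ.+ 3 → + x ≡ + 4 * + m - + 3
pellX-from-neo {x} {m} e = begin
  + x                      ≡⟨ identity (+ x) ⟩
  (+ x + + 3) - + 3        ≡⟨ cong (_- + 3) (pos-+ x 3) ⟨
  + (x ℕ.+ 3) - + 3        ≡⟨ cong (λ t → + t - + 3) e ⟨
  + (4 ℕ.* m) - + 3        ≡⟨ cong (_- + 3) (pos-* 4 m) ⟩
  + 4 * + m - + 3          ∎
  where
  open ≡-Reasoning
  identity : ∀ a → a ≡ (a + + 3) - + 3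
  identity = solve-∀

pell-balancing : ∀ k {F G} → + pellX k ≡ + 4 * F - + 3 → + pellY k ≡ G →
    (+ 6 * Bal k ≡ + 4 * F - G - + 3)
  × (+ 6 * LucBal k ≡ - (+ 8) * F + + 4 * G + + 6)
pell-balancing k {F} {G} hX hY =
  (begin
    + 6 * Bal k                          ≡⟨ Bal-from-pell k ⟩
    + pellX k - + pellY k                ≡⟨ cong₂ _-_ hX hY ⟩
    (+ 4 * F - + 3) - G                  ≡⟨ solve (F ∷ G ∷ []) ⟩
    + 4 * F - G - + 3                    ∎) ,
  (begin
    + 6 * LucBal k                       ≡⟨ LucBal-from-pell k ⟩
    + 4 * + pellY k - + 2 * + pellX k    ≡⟨ cong₂ (λ y x → + 4 * y - + 2 * x) hY hX ⟩
    + 4 * G - + 2 * (+ 4 * F - + 3)      ≡⟨ solve (F ∷ G ∷ []) ⟩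
    - (+ 8) * F + + 4 * G + + 6          ∎)
  where open ≡-Reasoning

neo-balancing : ∀ {f g} → NeoEnum f → NeoC f g → ∀ j →
    (+ 6 * Bal (suc (j ℕ.+ j)) ≡ + 4 * (+ f (suc j)) - + g (suc j) - + 3)
  × (+ 6 * LucBal (suc (j ℕ.+ j)) ≡ - (+ 8) * (+ f (suc j)) + + 4 * (+ g (suc j)) + + 6)
neo-balancing {f} {g} enum g² j = pell-balancing (suc (j ℕ.+ j)) {+ f (suc j)} {+ g (suc j)}
  (pellX-from-neo {m = f (suc j)} (neo-enumeration enum j))
  (cong +_ (sym (neo-companion enum {g} g² j)))

theorem4p1 : (f g : ℕ → ℕ) → NeoEnum f → NeoC f g → (j : ℕ) →
    ((+ 6 * Bal (suc (j ℕ.+ j)) ≡ + 4 * (+ f (suc j)) - + g (suc j) - + 3)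
    × (+ 12 * Cobal (suc (j ℕ.+ j)) ≡ - (+ 16) * (+ f (suc j)) + + 6 * (+ g (suc j)) + + 6)
    × (+ 6 * LucBal (suc (j ℕ.+ j)) ≡ - (+ 8) * (+ f (suc j)) + + 4 * (+ g (suc j)) + + 6)
    × (+ 6 * LucCobal (suc (j ℕ.+ j)) ≡ + 24 * (+ f (suc j)) - + 8 * (+ g (suc j)) - + 18))
  × ((+ 6 * Bal (suc (suc (j ℕ.+ j))) ≡ + 20 * (+ f (suc (suc j))) - + 7 * (+ g (suc (suc j))) - + 15)
    × (+ 12 * Cobal (suc (suc (j ℕ.+ j))) ≡ + 20 * (+ f (suc (suc j))) - + 4 * (+ f (suc j)) - + 7 * (+ g (suc (suc j))) + + g (suc j) - + 18)
    × (+ 6 * LucBal (suc (suc (j ℕ.+ j))) ≡ + 60 * (+ f (suc (suc j))) - + 4 * (+ f (suc j)) - + 21 * (+ g (suc (suc j))) + + g (suc j) - + 42)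
    × (+ 6 * LucCobal (suc (suc (j ℕ.+ j))) ≡ + 20 * (+ f (suc (suc j))) + + 4 * (+ f (suc j)) - + 7 * (+ g (suc (suc j))) - + g (suc j) - + 18))
theorem4p1 f g enum g² j =
  odd-identities (j ℕ.+ j) F₁ G₁ (proj₁ odd) (proj₂ odd) ,
  even-identities j F₁ G₁ F₂ G₂ (proj₁ odd) (proj₁ next-odd) (proj₂ next-odd)
  where
  F₁ = + f (suc j)
  G₁ = + g (suc j)
  F₂ = + f (suc (suc j))
  G₂ = + g (suc (suc j))
  odd = neo-balancing {f} {g} enum g² j
  next-odd = neo-balancing {f} {g} enum g² (suc j)
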